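{- For every board $B$ in the square grid, $d(B) = |B| - f(B)$, where $|B|$ is the number of cells of $B$.
   Context: Work in the square grid: cells are the unit squares of the plane with integer corners, and two cells are neighbors if they share an edge. A board is a finite set $B$ of cells such that every cell of $B$ has at least one neighbor in $B$. A domino is a set of two adjacent cells. A domino covering of $B$ is a finite collection (repetitions allowed) of dominoes, each contained in $B$, whose union is $B$. It is saturated if removing any single domino leaves some cell of $B$ uncovered. $d(B)$ denotes the largest number of dominoes in a saturated domino covering of $B$. A fragment is a set of cells consisting of a cell $c$ together with a nonempty subset of the four neighbors of $c$ (equivalently, a connected subset with at least two cells of an X-pentomino, where an X-pentomino is a cell together with its four neighbors). A fragment tiling of $B$ is a partition of $B$ into fragments, each contained in $B$. $f(B)$ denotes the minimum number of fragments in a fragment tiling of $B$. -}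

module Defs where

open import Data.Nat using (ℕ; _+_; _≤_)
open import Data.Integer as ℤ using (ℤ; ∣_∣; _-_)
open import Data.Product using (Σ; _×_; ∃; ∃-syntax; _,_; proj₁; proj₂)
open import Data.Sum using (_⊎_)
open import Data.Bool using (Bool; true; false; T; _∨_)
open import Data.Fin using (Fin)
open import Data.List using (List; length; lookup; removeAt)
open import Data.List.Membership.Propositional using (_∈_)
open import Data.List.Relation.Unary.All using (All)
open import Data.List.Relation.Unary.Any using (Any)
open import Data.List.Relation.Unary.Unique.Propositional using (Unique)
open import Relation.Binary.PropositionalEquality using (_≡_)
open import Relation.Nullary using (¬_)

-- A cell is identified with the integer coordinates of its lower-left corner.
Cell : Set
Cell = ℤ × ℤ

Adj : Cell → Cell → Set
Adj (x₁ , y₁) (x₂ , y₂) = ∣ x₁ - x₂ ∣ + ∣ y₁ - y₂ ∣ ≡ 1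

record Board : Set where
  field
    cells  : List Cell
    unique : Unique cells
    nbr    : ∀ c → c ∈ cells → ∃[ c' ] (c' ∈ cells × Adj c c')
open Board public

size : Board → ℕ
size B = length (cells B)

Domino : Set
Domino = Σ (Cell × Cell) (λ p → Adj (proj₁ p) (proj₂ p))

_∈D_ : Cell → Domino → Set
c ∈D ((a , b) , _) = c ≡ a ⊎ c ≡ b

-- every domino contained in B, and the union of the dominoes is B
-- (repetitions allowed: a list of dominoes)
IsDominoCovering : Board → List Domino → Set
IsDominoCovering B ds =
  All (λ δ → ∀ c → c ∈D δ → c ∈ cells B) ds ×
  (∀ c → c ∈ cells B → Any (c ∈D_) ds)

IsSaturated : Board → List Domino → Set
IsSaturated B ds =
  (i : Fin (length ds)) → ∃[ c ] (c ∈ cells B × ¬ Any (c ∈D_) (removeAt ds i))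

IsD : Board → ℕ → Set
IsD B n =
  (Σ (List Domino) λ ds → IsDominoCovering B ds × IsSaturated B ds × length ds ≡ n) ×
  (∀ ds → IsDominoCovering B ds → IsSaturated B ds → length ds ≤ n)

nb : Cell → Fin 4 → Cell
nb (x , y) Fin.zero = (x ℤ.+ ℤ.+ 1 , y)
nb (x , y) (Fin.suc Fin.zero) = (x ℤ.- ℤ.+ 1 , y)
nb (x , y) (Fin.suc (Fin.suc Fin.zero)) = (x , y ℤ.+ ℤ.+ 1)
nb (x , y) (Fin.suc (Fin.suc (Fin.suc Fin.zero))) = (x , y ℤ.- ℤ.+ 1)

record Fragment : Set where
  field
    center   : Cell
    sel      : Fin 4 → Bool
    nonempty : ∃[ k ] (sel k ≡ true)
open Fragment public

_∈F_ : Cell → Fragment → Set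
c ∈F F = c ≡ center F ⊎ ∃[ k ] (sel F k ≡ true × c ≡ nb (center F) k)

IsFragmentTiling : Board → List Fragment → Set
IsFragmentTiling B fs =
  All (λ F → ∀ c → c ∈F F → c ∈ cells B) fs ×
  (∀ c → c ∈ cells B →
     Σ (Fin (length fs)) λ i → c ∈F lookup fs i ×
       (∀ j → c ∈F lookup fs j → j ≡ i))

IsF : Board → ℕ → Set
IsF B m =
  (Σ (List Fragment) λ fs → IsFragmentTiling B fs × length fs ≡ m) ×
  (∀ fs → IsFragmentTiling B fs → m ≤ length fs)

-- A saturated covering gives every domino a private cell, covered by no other domino
-- (otherwise that domino could be removed). Orient each domino so that its second cell,
-- its leaf, is private. Distinct dominoes then have distinct leaves and no leaf is the root
-- of a domino, so the stars formed by each non-leaf cell and the leaves hanging from it tile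
-- B with at most |B| − d fragments, d the number of dominoes. Conversely, joining the centre
-- of each fragment of a tiling to its other cells gives a saturated covering, each
-- non-centre cell being private, with at least |B| − f dominoes, f the number of fragments.
-- A saturated covering has at most |B| dominoes, all inside B, so a longest one is found by
-- exhaustive search, and the two inequalities show that it realises d(B) while
-- |B| − d(B) is the least number of fragments.
module Submission where

open import Defs
open import Data.Nat using (_+_)
open import Data.Product using (∃-syntax; _×_)
open import Relation.Binary.PropositionalEquality using (_≡_)

open import Data.Bool as Bool using (Bool; true)
open import Data.Bool.Properties using (T-≡)
open import Data.Empty using (⊥-elim)
open import Data.Fin using (Fin; zero; suc)
import Data.Fin.Properties as Fin
open import Data.Integer as ℤ using (ℤ; ∣_∣; _-_; 0ℤ; 1ℤ; -1ℤ)
open import Data.Integer.Properties using (+-inverseʳ; ∣i-j∣≡∣j-i∣)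
open import Data.Integer.Tactic.RingSolver using (solve-∀)
open import Data.List
  using ( List; []; _∷_; [_]; length; filter; lookup; removeAt; map; _++_; concatMap; allFin
        ; cartesianProductWith)
open import Data.List.Properties
  using (length-++; length-map; length-removeAt′; filter-++; filter-none; filter-some; filter-accept)
open import Data.List.Extrema.Nat using (argmax; argmax-all; f[xs]≤f[argmax])
open import Data.List.Membership.Propositional using (_∈_; lose; find; mapWith∈)
open import Data.List.Membership.Propositional.Properties
  using ( ∈-map⁺; ∈-map⁻; ∈-lookup; ∈-filter⁺; ∈-filter⁻; ∈-allFin; ∈-concatMap⁺; ∈-concatMap⁻
        ; ∈-++⁺ˡ; ∈-++⁺ʳ; ∈-++⁻; ∈-cartesianProductWith⁺)
open import Data.List.Relation.Binary.Subset.Propositional using (_⊆_)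
open import Data.List.Relation.Unary.All as All using (All; []; _∷_)
open import Data.List.Relation.Unary.All.Properties as All using (¬Any⇒All¬; ¬All⇒Any¬)
open import Data.List.Relation.Unary.Any as Any using (Any; here; there; _─_)
open import Data.List.Relation.Unary.Any.Properties as Any using (lookup-index)
open import Data.List.Relation.Unary.Unique.Propositional using (Unique; []; _∷_)
import Data.List.Relation.Unary.Unique.Propositional.Properties as Unique
open import Data.Nat as ℕ using (ℕ; zero; suc; _≤_; z≤n; s≤s)
open import Data.Nat.Properties
  using ( 0≢1+n; suc-injective; +-identityʳ; +-comm; ≤-refl; ≤-reflexive; ≤-trans; ≤-antisym
        ; ≤-pred; n≤1+n; n≤0⇒n≡0; <⇒≢; ≡-irrelevant; m+n≤o⇒n≤o; +-cancelʳ-≤; +-monoʳ-≤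
        ; module ≤-Reasoning)
open import Data.Product using (Σ; _,_; proj₁; proj₂)
open import Data.Product.Properties using (≡-dec)
open import Data.Sum as Sum using (_⊎_; inj₁; inj₂)
open import Function using (_∘_; id; Equivalence)
open import Relation.Binary.Definitions using (DecidableEquality)
open import Relation.Binary.PropositionalEquality
  using (_≢_; refl; sym; trans; cong; cong₂; subst)
open import Relation.Nullary using (¬_; Dec; yes; no; ¬?)
open import Relation.Nullary.Decidable
  using (_×-dec_; _⊎-dec_; ⌊_⌋; toWitness; fromWitness; map′)
open import Relation.Unary using (Decidable)

_⊖_ : Cell → Cell → ℤ × ℤ
(x₁ , y₁) ⊖ (x₂ , y₂) = x₁ - x₂ , y₁ - y₂

∥_∥ : ℤ × ℤ → ℕ
∥ p , q ∥ = ∣ p ∣ + ∣ q ∣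

offset : Fin 4 → ℤ × ℤ
offset zero                   = -1ℤ , 0ℤ
offset (suc zero)             = 1ℤ , 0ℤ
offset (suc (suc zero))       = 0ℤ , -1ℤ
offset (suc (suc (suc zero))) = 0ℤ , 1ℤ

-- A left inverse of offset; its values on other vectors are irrelevant.
direction : ℤ × ℤ → Fin 4
direction (ℤ.+ 1 , _)          = suc zero
direction (ℤ.+ 0 , ℤ.-[1+ 0 ]) = suc (suc zero)
direction (ℤ.+ 0 , _)          = suc (suc (suc zero))
direction _                    = zero

direction-offset : ∀ k → direction (offset k) ≡ k
direction-offset zero                   = refl
direction-offset (suc zero)             = refl
direction-offset (suc (suc zero))       = refl
direction-offset (suc (suc (suc zero))) = refl

offset-injective : ∀ {k k'} → offset k ≡ offset k' → k ≡ k'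
offset-injective {k} {k'} e =
  trans (sym (direction-offset k)) (trans (cong direction e) (direction-offset k'))

∥offset∥≡1 : ∀ k → ∥ offset k ∥ ≡ 1
∥offset∥≡1 zero                   = refl
∥offset∥≡1 (suc zero)             = refl
∥offset∥≡1 (suc (suc zero))       = refl
∥offset∥≡1 (suc (suc (suc zero))) = refl

∥p∥≡1⇒offset : ∀ p → ∥ p ∥ ≡ 1 → ∃[ k ] p ≡ offset k
∥p∥≡1⇒offset (ℤ.-[1+ 0 ]          , ℤ.+ 0)               refl = zero , refl
∥p∥≡1⇒offset (ℤ.+ 1               , ℤ.+ 0)               refl = suc zero , refl
∥p∥≡1⇒offset (ℤ.+ 0               , ℤ.-[1+ 0 ])          refl = suc (suc zero) , refl
∥p∥≡1⇒offset (ℤ.+ 0               , ℤ.+ 1)               refl = suc (suc (suc zero)) , refl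
∥p∥≡1⇒offset (ℤ.+ 0               , ℤ.+ 0)               ()
∥p∥≡1⇒offset (ℤ.+ 0               , ℤ.+ ℕ.suc (ℕ.suc _)) ()
∥p∥≡1⇒offset (ℤ.+ 0               , ℤ.-[1+ ℕ.suc _ ])    ()
∥p∥≡1⇒offset (ℤ.+ 1               , ℤ.+ ℕ.suc _)         ()
∥p∥≡1⇒offset (ℤ.+ 1               , ℤ.-[1+ _ ])          ()
∥p∥≡1⇒offset (ℤ.-[1+ 0 ]          , ℤ.+ ℕ.suc _)         ()
∥p∥≡1⇒offset (ℤ.-[1+ 0 ]          , ℤ.-[1+ _ ])          ()
∥p∥≡1⇒offset (ℤ.+ ℕ.suc (ℕ.suc _) , _)                   ()
∥p∥≡1⇒offset (ℤ.-[1+ ℕ.suc _ ]    , _)                   ()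

i-[i-j]≡j : ∀ i j → i - (i - j) ≡ j
i-[i-j]≡j = solve-∀

i-j≡i-k⇒j≡k : ∀ i j k → i - j ≡ i - k → j ≡ k
i-j≡i-k⇒j≡k i j k e = trans (sym (i-[i-j]≡j i j)) (trans (cong (i -_) e) (i-[i-j]≡j i k))

⊖-cancelˡ : ∀ a b c → a ⊖ b ≡ a ⊖ c → b ≡ c
⊖-cancelˡ (x₁ , y₁) (x₂ , y₂) (x₃ , y₃) e =
  cong₂ _,_ (i-j≡i-k⇒j≡k x₁ x₂ x₃ (cong proj₁ e)) (i-j≡i-k⇒j≡k y₁ y₂ y₃ (cong proj₂ e))

⊖-nb : ∀ c k → c ⊖ nb c k ≡ offset k
⊖-nb (x , y) zero                   = cong₂ _,_ (i-[i-j]≡j x -1ℤ) (+-inverseʳ y)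
⊖-nb (x , y) (suc zero)             = cong₂ _,_ (i-[i-j]≡j x 1ℤ) (+-inverseʳ y)
⊖-nb (x , y) (suc (suc zero))       = cong₂ _,_ (+-inverseʳ x) (i-[i-j]≡j y -1ℤ)
⊖-nb (x , y) (suc (suc (suc zero))) = cong₂ _,_ (+-inverseʳ x) (i-[i-j]≡j y 1ℤ)

nb-injective : ∀ c {k k'} → nb c k ≡ nb c k' → k ≡ k'
nb-injective c {k} {k'} e =
  offset-injective (trans (sym (⊖-nb c k)) (trans (cong (c ⊖_) e) (⊖-nb c k')))

adj-nb : ∀ c k → Adj c (nb c k)
adj-nb c k = subst (λ p → ∥ p ∥ ≡ 1) (sym (⊖-nb c k)) (∥offset∥≡1 k)

adj⇒nb : ∀ a b → Adj a b → ∃[ k ] b ≡ nb a k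
adj⇒nb a b adj with k , e ← ∥p∥≡1⇒offset (a ⊖ b) adj =
  k , ⊖-cancelˡ a b (nb a k) (trans e (sym (⊖-nb a k)))

adj-irrefl : ∀ c → ¬ Adj c c
adj-irrefl (x , y) adj =
  0≢1+n (trans (sym (cong₂ (λ p q → ∣ p ∣ + ∣ q ∣) (+-inverseʳ x) (+-inverseʳ y))) adj)

adj-sym : ∀ a b → Adj a b → Adj b a
adj-sym (x₁ , y₁) (x₂ , y₂) adj =
  trans (cong₂ _+_ (∣i-j∣≡∣j-i∣ x₂ x₁) (∣i-j∣≡∣j-i∣ y₂ y₁)) adj

nb≢ : ∀ c k → nb c k ≢ c
nb≢ c k e = adj-irrefl c (subst (Adj c) e (adj-nb c k))

module _ {A : Set} {P : A → Set} (P? : Decidable P) where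

  count : List A → ℕ
  count xs = length (filter P? xs)

  count-++ : ∀ xs ys → count (xs ++ ys) ≡ count xs + count ys
  count-++ xs ys = trans (cong length (filter-++ P? xs ys)) (length-++ (filter P? xs))

  count-∷-≥ : ∀ x xs → count xs ≤ count (x ∷ xs)
  count-∷-≥ x xs with P? x
  ... | yes _ = n≤1+n _
  ... | no  _ = ≤-refl

  ¬Any⇒count≡0 : ∀ {xs} → ¬ Any P xs → count xs ≡ 0
  ¬Any⇒count≡0 {xs} ¬any = cong length (filter-none P? (¬Any⇒All¬ xs ¬any))

  count≡0⇒¬Any : ∀ {xs} → count xs ≡ 0 → ¬ Any P xs
  count≡0⇒¬Any c≡0 any = <⇒≢ (filter-some P? any) (sym c≡0)

  count-removeAt : ∀ xs i → P (lookup xs i) → count xs ≡ suc (count (removeAt xs i))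
  count-removeAt (x ∷ xs) zero    px = cong length (filter-accept P? px)
  count-removeAt (x ∷ xs) (suc i) px with P? x
  ... | yes _ = cong suc (count-removeAt xs i px)
  ... | no  _ = count-removeAt xs i px

  count≡1⇒unique : ∀ xs → count xs ≡ 1 → ∀ {x y} → x ∈ xs → y ∈ xs → P x → P y → x ≡ y
  count≡1⇒unique (z ∷ xs) c≡1 x∈ y∈ px py with P? z
  ... | yes _ = trans (isHead x∈ px) (sym (isHead y∈ py))
    where
    isHead : ∀ {w} → w ∈ z ∷ xs → P w → w ≡ z
    isHead (here w≡z) _  = w≡z
    isHead (there w∈) pw = ⊥-elim (count≡0⇒¬Any (suc-injective c≡1) (lose w∈ pw))
  ... | no ¬pz = count≡1⇒unique xs c≡1 (inTail x∈ px) (inTail y∈ py) px py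
    where
    inTail : ∀ {w} → w ∈ z ∷ xs → P w → w ∈ xs
    inTail (here refl) pw = ⊥-elim (¬pz pw)
    inTail (there w∈) _   = w∈

  unique⇒count≡1 : ∀ {xs x} → Unique xs → x ∈ xs → P x →
                   (∀ {y} → y ∈ xs → P y → y ≡ x) → count xs ≡ 1
  unique⇒count≡1 {z ∷ xs} (z∉ ∷ _) (here refl) px only =
    trans (cong length (filter-accept P? px)) (cong suc (¬Any⇒count≡0 ¬inTail))
    where
    ¬inTail : ¬ Any P xs
    ¬inTail any with y , y∈ , py ← find any = All.lookup z∉ y∈ (sym (only (there y∈) py))
  unique⇒count≡1 {z ∷ xs} (z∉ ∷ u) (there x∈) px only with P? z
  ... | yes pz = ⊥-elim (All.lookup z∉ x∈ (only (here refl) pz))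
  ... | no  _  = unique⇒count≡1 u x∈ px (only ∘ there)

module _ {A B : Set} {R : B → A → Set} (R? : ∀ b → Decidable (R b))
         (f : A → B) (R[fx]x : ∀ x → R (f x) x) where

  count≤1⇒unique-map : ∀ xs → (∀ {x} → x ∈ xs → count (R? (f x)) xs ≤ 1) → Unique (map f xs)
  count≤1⇒unique-map []       _          = []
  count≤1⇒unique-map (x ∷ xs) atMostOnce =
    All.map⁺ (All.map distinct (¬Any⇒All¬ xs ¬inTail)) ∷ count≤1⇒unique-map xs atMostOnceInTail
    where
    ¬inTail : ¬ Any (R (f x)) xs
    ¬inTail = count≡0⇒¬Any (R? (f x))
                (n≤0⇒n≡0 (≤-pred (subst (_≤ 1) counted (atMostOnce (here refl)))))
      where counted = cong length (filter-accept (R? (f x)) (R[fx]x x))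

    distinct : ∀ {y} → ¬ R (f x) y → f x ≢ f y
    distinct ¬R fx≡fy = ¬R (subst (λ b → R b _) (sym fx≡fy) (R[fx]x _))

    atMostOnceInTail : ∀ {y} → y ∈ xs → count (R? (f y)) xs ≤ 1
    atMostOnceInTail {y} y∈ = ≤-trans (count-∷-≥ (R? (f y)) x xs) (atMostOnce (there y∈))

module _ {A B : Set} {P : B → Set} (P? : Decidable P) (f : A → List B) where

  count-concatMap-sole : ∀ xs i → (∀ j → Any P (f (lookup xs j)) → j ≡ i) →
                         count P? (concatMap f xs) ≡ count P? (f (lookup xs i))
  count-concatMap-sole (x ∷ xs) zero only =
    trans (count-++ P? (f x) (concatMap f xs))
          (trans (cong (count P? (f x) +_) (¬Any⇒count≡0 P? ¬inTail)) (+-identityʳ _))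
    where
    ¬inTail : ¬ Any P (concatMap f xs)
    ¬inTail any with p ← Any.concatMap⁻ f {xs = xs} any =
      Fin.0≢1+n (sym (only (suc (Any.index p)) (lookup-index p)))
  count-concatMap-sole (x ∷ xs) (suc i) only =
    trans (count-++ P? (f x) (concatMap f xs))
          (cong₂ _+_ (¬Any⇒count≡0 P? (Fin.0≢1+n ∘ only zero))
                     (count-concatMap-sole xs i (λ j → Fin.suc-injective ∘ only (suc j))))

module _ {A : Set} where

  ∈-─⁺ : ∀ {x z : A} {ys} (x∈ : x ∈ ys) → z ∈ ys → z ≢ x → z ∈ (ys ─ x∈)
  ∈-─⁺ (here refl) (here refl) z≢x = ⊥-elim (z≢x refl)
  ∈-─⁺ (here _)    (there z∈)  _   = z∈
  ∈-─⁺ (there _)   (here refl) _   = here refl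
  ∈-─⁺ (there x∈)  (there z∈)  z≢x = there (∈-─⁺ x∈ z∈ z≢x)

  Unique⇒length≤ : ∀ {xs ys : List A} → Unique xs → xs ⊆ ys → length xs ≤ length ys
  Unique⇒length≤ {[]}          _        _     = z≤n
  Unique⇒length≤ {x ∷ xs} {ys} (x∉ ∷ u) xs⊆ys =
    ≤-trans (s≤s (Unique⇒length≤ u xs⊆ys─x))
            (≤-reflexive (sym (length-removeAt′ ys (Any.index x∈ys))))
    where
    x∈ys = xs⊆ys (here refl)
    xs⊆ys─x : xs ⊆ (ys ─ x∈ys)
    xs⊆ys─x z∈ = ∈-─⁺ x∈ys (xs⊆ys (there z∈)) (λ z≡x → All.lookup x∉ z∈ (sym z≡x))

module _ {A K : Set} (key : A → K) where

  Unique[map]⇒lookup-injective : ∀ {xs} → Unique (map key xs) → ∀ i j →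
                                 key (lookup xs i) ≡ key (lookup xs j) → i ≡ j
  Unique[map]⇒lookup-injective {_ ∷ _} _        zero    zero    _ = refl
  Unique[map]⇒lookup-injective {_ ∷ _} (x∉ ∷ _) zero    (suc j) e =
    ⊥-elim (All.lookup x∉ (∈-map⁺ key (∈-lookup j)) e)
  Unique[map]⇒lookup-injective {_ ∷ _} (x∉ ∷ _) (suc i) zero    e =
    ⊥-elim (All.lookup x∉ (∈-map⁺ key (∈-lookup i)) (sym e))
  Unique[map]⇒lookup-injective {_ ∷ _} (_ ∷ u)  (suc i) (suc j) e =
    cong suc (Unique[map]⇒lookup-injective u i j e)

module _ {A : Set} {P : A → Set} where

  ¬Any-removeAt⇒lookup : ∀ xs i → Any P xs → ¬ Any P (removeAt xs i) → P (lookup xs i)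
  ¬Any-removeAt⇒lookup (x ∷ xs) zero    (here px) _    = px
  ¬Any-removeAt⇒lookup (x ∷ xs) zero    (there p) ¬any = ⊥-elim (¬any p)
  ¬Any-removeAt⇒lookup (x ∷ xs) (suc i) (here px) ¬any = ⊥-elim (¬any (here px))
  ¬Any-removeAt⇒lookup (x ∷ xs) (suc i) (there p) ¬any =
    ¬Any-removeAt⇒lookup xs i p (¬any ∘ there)

  All-removeAt : ∀ xs i → All P xs → All P (removeAt xs i)
  All-removeAt (x ∷ xs) zero    (_  ∷ ps) = ps
  All-removeAt (x ∷ xs) (suc i) (px ∷ ps) = px ∷ All-removeAt xs i ps

_≟ᶜ_ : DecidableEquality Cell
_≟ᶜ_ = ≡-dec ℤ._≟_ ℤ._≟_

_∈D?_ : ∀ c δ → Dec (c ∈D δ)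
c ∈D? ((a , b) , _) = (c ≟ᶜ a) ⊎-dec (c ≟ᶜ b)

multiplicity : Cell → List Domino → ℕ
multiplicity c = count (c ∈D?_)

SaturatedCovering : Board → List Domino → Set
SaturatedCovering B ds = IsDominoCovering B ds × IsSaturated B ds

module _ (B : Board) (ds : List Domino) where

  privateCells⇒saturated :
    (∀ i → ∃[ c ] c ∈ cells B × c ∈D lookup ds i × multiplicity c ds ≡ 1) → IsSaturated B ds
  privateCells⇒saturated privateCell i with c , c∈B , c∈δ , once ← privateCell i =
    c , c∈B , count≡0⇒¬Any (c ∈D?_) (suc-injective (trans (sym removed) once))
    where removed = count-removeAt (c ∈D?_) ds i c∈δ

  saturated⇒privateCell : SaturatedCovering B ds →
                          ∀ {δ} → δ ∈ ds → ∃[ c ] c ∈D δ × multiplicity c ds ≡ 1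
  saturated⇒privateCell ((_ , covers) , saturated) δ∈
    with c , c∈B , ¬covered ← saturated (Any.index δ∈) =
    c , subst (c ∈D_) (sym (lookup-index δ∈)) c∈δᵢ ,
    trans (count-removeAt (c ∈D?_) ds i c∈δᵢ) (cong suc (¬Any⇒count≡0 (c ∈D?_) ¬covered))
    where
    i = Any.index δ∈
    c∈δᵢ = ¬Any-removeAt⇒lookup ds i (covers c c∈B) ¬covered

-- From a fragment tiling to a saturated covering

selected? : ∀ F k → Dec (sel F k ≡ true)
selected? F k = sel F k Bool.≟ true

selected : Fragment → List (Fin 4)
selected F = filter (selected? F) (allFin 4)

∈-selected⁺ : ∀ F {k} → sel F k ≡ true → k ∈ selected F
∈-selected⁺ F = ∈-filter⁺ (selected? F) (∈-allFin _)

∈-selected⁻ : ∀ F {k} → k ∈ selected F → sel F k ≡ true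
∈-selected⁻ F = proj₂ ∘ ∈-filter⁻ (selected? F)

dominoAt : Cell → Fin 4 → Domino
dominoAt c k = (c , nb c k) , adj-nb c k

dominoAt-injective : ∀ c {k k'} → dominoAt c k ≡ dominoAt c k' → k ≡ k'
dominoAt-injective c e = nb-injective c (cong (proj₂ ∘ proj₁) e)

fragmentDominoes : Fragment → List Domino
fragmentDominoes F = map (dominoAt (center F)) (selected F)

∈-fragmentDominoes⁺ : ∀ F {k} → sel F k ≡ true → dominoAt (center F) k ∈ fragmentDominoes F
∈-fragmentDominoes⁺ F = ∈-map⁺ (dominoAt (center F)) ∘ ∈-selected⁺ F

∈F⇒covered : ∀ F {x} → x ∈F F → Any (x ∈D_) (fragmentDominoes F)
∈F⇒covered F (inj₁ refl) with k , sk ← nonempty F = lose (∈-fragmentDominoes⁺ F sk) (inj₁ refl)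
∈F⇒covered F (inj₂ (k , sk , refl))                = lose (∈-fragmentDominoes⁺ F sk) (inj₂ refl)

covered⇒∈F : ∀ F {x} → Any (x ∈D_) (fragmentDominoes F) → x ∈F F
covered⇒∈F F covered with k , k∈ , x∈δ ← find (Any.map⁻ covered) with x∈δ
... | inj₁ x≡c  = inj₁ x≡c
... | inj₂ x≡nb = inj₂ (k , ∈-selected⁻ F k∈ , x≡nb)

multiplicity-fragmentDominoes : ∀ F {k} → sel F k ≡ true →
                                multiplicity (nb (center F) k) (fragmentDominoes F) ≡ 1
multiplicity-fragmentDominoes F {k} sk =
  unique⇒count≡1 (nb c k ∈D?_)
    (Unique.map⁺ (dominoAt-injective c) (Unique.filter⁺ (selected? F) (Unique.allFin⁺ 4)))
    (∈-fragmentDominoes⁺ F sk) (inj₂ refl) only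
  where
  c = center F
  only : ∀ {δ} → δ ∈ fragmentDominoes F → nb c k ∈D δ → δ ≡ dominoAt c k
  only δ∈ covers with k' , _ , refl ← ∈-map⁻ (dominoAt c) δ∈ with covers
  ... | inj₁ nb≡c  = ⊥-elim (nb≢ c k nb≡c)
  ... | inj₂ nb≡nb = cong (dominoAt c) (sym (nb-injective c nb≡nb))

tiling⇒saturatedCovering : ∀ B fs → IsFragmentTiling B fs →
  ∃[ ds ] IsDominoCovering B ds × IsSaturated B ds × size B ≤ length fs + length ds
tiling⇒saturatedCovering B fs (inBoard , partition) =
  ds , (dominoesInBoard , covers) , privateCells⇒saturated B ds privateCell , size≤
  where
  ds = concatMap fragmentDominoes fs

  fragmentOf : ∀ {δ} → δ ∈ ds → ∃[ F ] F ∈ fs × δ ∈ fragmentDominoes F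
  fragmentOf = find ∘ ∈-concatMap⁻ fragmentDominoes

  dominoAt∈ds : ∀ i {k} → sel (lookup fs i) k ≡ true → dominoAt (center (lookup fs i)) k ∈ ds
  dominoAt∈ds i sk = ∈-concatMap⁺ fragmentDominoes {xs = fs}
                       (lose (∈-lookup i) (∈-fragmentDominoes⁺ (lookup fs i) sk))

  dominoesInBoard : All (λ δ → ∀ c → c ∈D δ → c ∈ cells B) ds
  dominoesInBoard = All.tabulate λ δ∈ c c∈δ →
    let F , F∈ , δ∈F = fragmentOf δ∈ in All.lookup inBoard F∈ c (covered⇒∈F F (lose δ∈F c∈δ))

  covers : ∀ c → c ∈ cells B → Any (c ∈D_) ds
  covers c c∈B =
    let i , c∈F , _ = partition c c∈B
    in Any.concatMap⁺ fragmentDominoes {xs = fs} (lose (∈-lookup i) (∈F⇒covered (lookup fs i) c∈F))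

  privateCell : ∀ j → ∃[ c ] c ∈ cells B × c ∈D lookup ds j × multiplicity c ds ≡ 1
  privateCell j with F , F∈ , δ∈F ← fragmentOf (∈-lookup j)
                 with k , k∈ , δ≡ ← ∈-map⁻ (dominoAt (center F)) δ∈F =
    x , x∈B , subst (x ∈D_) (sym δ≡) (inj₂ refl) , once
    where
    x = nb (center F) k
    sk = ∈-selected⁻ F k∈
    x∈F : x ∈F F
    x∈F = inj₂ (k , sk , refl)
    x∈B = All.lookup inBoard F∈ x x∈F
    i = proj₁ (partition x x∈B)
    only = proj₂ (proj₂ (partition x x∈B))
    Fᵢ≡F : lookup fs i ≡ F
    Fᵢ≡F = trans (cong (lookup fs) (sym (only (Any.index F∈) (subst (x ∈F_) F≡Fᵢ x∈F)))) (sym F≡Fᵢ)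
      where F≡Fᵢ = lookup-index F∈
    once : multiplicity x ds ≡ 1
    once = trans (count-concatMap-sole (x ∈D?_) fragmentDominoes fs i
                    (λ j → only j ∘ covered⇒∈F (lookup fs j)))
                 (subst (λ F′ → multiplicity x (fragmentDominoes F′) ≡ 1) (sym Fᵢ≡F)
                        (multiplicity-fragmentDominoes F sk))

  size≤ : size B ≤ length fs + length ds
  size≤ = ≤-trans (Unique⇒length≤ (unique B) cells⊆)
                  (≤-reflexive (trans (length-++ (map center fs))
                                      (cong₂ _+_ (length-map center fs) (length-map _ ds))))
    where
    cells⊆ : ∀ {c} → c ∈ cells B → c ∈ map center fs ++ map (proj₂ ∘ proj₁) ds
    cells⊆ {c} c∈B with i , c∈F , _ ← partition c c∈B with c∈F
    ... | inj₁ refl            = ∈-++⁺ˡ (∈-map⁺ center (∈-lookup {xs = fs} i))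
    ... | inj₂ (k , sk , refl) = ∈-++⁺ʳ (map center fs) (∈-map⁺ (proj₂ ∘ proj₁) (dominoAt∈ds i sk))

-- From a saturated covering to a fragment tiling

flipDomino : Domino → Domino
flipDomino ((a , b) , adj) = (b , a) , adj-sym a b adj

module FromSaturatedCovering (B : Board) (ds : List Domino)
                             (saturatedCovering : SaturatedCovering B ds) where

  covering = proj₁ saturatedCovering

  -- The second cell of an oriented domino, its leaf, has multiplicity one: saturation makes
  -- one of the two cells of a domino of ds private.
  orient : Domino → Domino
  orient δ with multiplicity (proj₂ (proj₁ δ)) ds ℕ.≟ 1
  ... | yes _ = δ
  ... | no  _ = flipDomino δ

  root leaf : Domino → Cell
  root = proj₁ ∘ proj₁ ∘ orient
  leaf = proj₂ ∘ proj₁ ∘ orient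

  ∈D-orient⁻ : ∀ δ {c} → c ∈D orient δ → c ∈D δ
  ∈D-orient⁻ δ with multiplicity (proj₂ (proj₁ δ)) ds ℕ.≟ 1
  ... | yes _ = id
  ... | no  _ = Sum.swap

  ∈D-orient⁺ : ∀ δ {c} → c ∈D δ → c ∈D orient δ
  ∈D-orient⁺ δ with multiplicity (proj₂ (proj₁ δ)) ds ℕ.≟ 1
  ... | yes _ = id
  ... | no  _ = Sum.swap

  root∈D : ∀ δ → root δ ∈D δ
  root∈D δ = ∈D-orient⁻ δ (inj₁ refl)

  leaf∈D : ∀ δ → leaf δ ∈D δ
  leaf∈D δ = ∈D-orient⁻ δ (inj₂ refl)

  root-adj-leaf : ∀ δ → Adj (root δ) (leaf δ)
  root-adj-leaf = proj₂ ∘ orient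

  inBoard : ∀ {δ c} → δ ∈ ds → c ∈D δ → c ∈ cells B
  inBoard δ∈ = All.lookup (proj₁ covering) δ∈ _

  leaf-private : ∀ {δ} → δ ∈ ds → multiplicity (leaf δ) ds ≡ 1
  leaf-private {δ} δ∈ with saturated⇒privateCell B ds saturatedCovering δ∈
                         | multiplicity (proj₂ (proj₁ δ)) ds ℕ.≟ 1
  ... | _                         | yes second-private = second-private
  ... | _ , inj₁ refl , c-private | no _               = c-private
  ... | _ , inj₂ refl , c-private | no ¬second-private = ⊥-elim (¬second-private c-private)

  leaf-determines : ∀ {δ δ'} → δ ∈ ds → δ' ∈ ds → leaf δ ∈D δ' → δ' ≡ δ
  leaf-determines {δ} δ∈ δ'∈ leaf∈δ' =
    count≡1⇒unique (leaf δ ∈D?_) ds (leaf-private δ∈) δ'∈ δ∈ leaf∈δ' (leaf∈D δ)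

  IsLeaf : Cell → Set
  IsLeaf x = Any (λ δ → leaf δ ≡ x) ds

  isLeaf? : Decidable IsLeaf
  isLeaf? x = Any.any? (λ δ → leaf δ ≟ᶜ x) ds

  root-not-leaf : ∀ {δ} → δ ∈ ds → ¬ IsLeaf (root δ)
  root-not-leaf {δ} δ∈ isLeaf with δ' , δ'∈ , leaf≡root ← find isLeaf =
    adj-irrefl (root δ) (subst (Adj (root δ)) (trans (cong leaf δ≡δ') leaf≡root) (root-adj-leaf δ))
    where
    δ≡δ' = leaf-determines δ'∈ δ∈ (subst (_∈D δ) (sym leaf≡root) (root∈D δ))

  Hangs : Cell → Cell → Set
  Hangs y x = Any (λ δ → root δ ≡ y × leaf δ ≡ x) ds

  hangs? : ∀ y x → Dec (Hangs y x)
  hangs? y x = Any.any? (λ δ → (root δ ≟ᶜ y) ×-dec (leaf δ ≟ᶜ x)) ds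

  root-hangs : ∀ {δ} → δ ∈ ds → Hangs (root δ) (leaf δ)
  root-hangs δ∈ = lose δ∈ (refl , refl)

  hangs⇒leaf : ∀ {y x} → Hangs y x → IsLeaf x
  hangs⇒leaf = Any.map proj₂

  hangs-functional : ∀ {y y' x} → Hangs y x → Hangs y' x → y ≡ y'
  hangs-functional h h'
    with δ , δ∈ , refl , refl ← find h | δ' , δ'∈ , refl , leaf′≡leaf ← find h' =
    cong root (sym (leaf-determines δ∈ δ'∈ (subst (_∈D δ') leaf′≡leaf (leaf∈D δ'))))

  hangs⇒nb : ∀ {y x} → Hangs y x → ∃[ k ] x ≡ nb y k
  hangs⇒nb h with δ , _ , refl , refl ← find h = adj⇒nb (root δ) (leaf δ) (root-adj-leaf δ)

  centers : List Cell
  centers = filter (¬? ∘ isLeaf?) (cells B)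

  center∈B : ∀ {y} → y ∈ centers → y ∈ cells B
  center∈B = proj₁ ∘ ∈-filter⁻ (¬? ∘ isLeaf?) {xs = cells B}

  center-not-leaf : ∀ {y} → y ∈ centers → ¬ IsLeaf y
  center-not-leaf = proj₂ ∘ ∈-filter⁻ (¬? ∘ isLeaf?) {xs = cells B}

  root∈centers : ∀ {δ} → δ ∈ ds → root δ ∈ centers
  root∈centers δ∈ = ∈-filter⁺ (¬? ∘ isLeaf?) (inBoard δ∈ (root∈D _)) (root-not-leaf δ∈)

  starSel : Cell → Fin 4 → Bool
  starSel y k = ⌊ hangs? y (nb y k) ⌋

  starSel⇒hangs : ∀ {y k} → starSel y k ≡ true → Hangs y (nb y k)
  starSel⇒hangs {y} {k} e = toWitness {a? = hangs? y (nb y k)} (Equivalence.from T-≡ e)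

  hangs⇒starSel : ∀ {y k} → Hangs y (nb y k) → starSel y k ≡ true
  hangs⇒starSel h = Equivalence.to T-≡ (fromWitness h)

  NonemptyStar : Cell → Set
  NonemptyStar y = ∃[ k ] starSel y k ≡ true

  root-nonempty : ∀ {δ} → δ ∈ ds → NonemptyStar (root δ)
  root-nonempty {δ} δ∈ =
    let k , leaf≡nb = hangs⇒nb (root-hangs δ∈) in
    k , hangs⇒starSel {root δ} {k} (subst (Hangs (root δ)) leaf≡nb (root-hangs δ∈))

  center-nonempty : ∀ {y} → y ∈ centers → NonemptyStar y
  center-nonempty y∈ with δ , δ∈ , y∈δ ← find (proj₂ covering _ (center∈B y∈))
                     with ∈D-orient⁺ δ y∈δ
  ... | inj₁ y≡root = subst NonemptyStar (sym y≡root) (root-nonempty δ∈)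
  ... | inj₂ y≡leaf = ⊥-elim (center-not-leaf y∈ (lose δ∈ (sym y≡leaf)))

  star : (y : Cell) → NonemptyStar y → Fragment
  star y ne = record { center = y ; sel = starSel y ; nonempty = ne }

  ∈star⁻ : ∀ {x y ne} → x ∈F star y ne → x ≡ y ⊎ Hangs y x
  ∈star⁻ (inj₁ x≡y)             = inj₁ x≡y
  ∈star⁻ (inj₂ (_ , sk , refl)) = inj₂ (starSel⇒hangs sk)

  ∈star⁺ : ∀ {x y ne} → x ≡ y ⊎ Hangs y x → x ∈F star y ne
  ∈star⁺ (inj₁ x≡y) = inj₁ x≡y
  ∈star⁺ (inj₂ h) with k , refl ← hangs⇒nb h = inj₂ (k , hangs⇒starSel h , refl)

  stars : (ys : List Cell) → All NonemptyStar ys → List Fragment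
  stars []       []         = []
  stars (y ∷ ys) (ne ∷ nes) = star y ne ∷ stars ys nes

  centers-stars : ∀ ys nes → map center (stars ys nes) ≡ ys
  centers-stars []       []        = refl
  centers-stars (y ∷ ys) (_ ∷ nes) = cong (y ∷_) (centers-stars ys nes)

  ∈-stars⁺ : ∀ {ys nes y} → y ∈ ys → ∃[ ne ] star y ne ∈ stars ys nes
  ∈-stars⁺ {_ ∷ _} {ne ∷ _} (here refl) = ne , here refl
  ∈-stars⁺ {_ ∷ _} {_ ∷ _}  (there y∈) with ne , F∈ ← ∈-stars⁺ y∈ = ne , there F∈

  star-shaped : ∀ ys nes →
    All (λ F → ∀ {x} → x ∈F F → x ≡ center F ⊎ Hangs (center F) x) (stars ys nes)
  star-shaped []       []         = []
  star-shaped (y ∷ ys) (ne ∷ nes) = ∈star⁻ {ne = ne} ∷ star-shaped ys nes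

  centers-nonempty : All NonemptyStar centers
  centers-nonempty = All.tabulate center-nonempty

  fs : List Fragment
  fs = stars centers centers-nonempty

  shape : ∀ {F x} → F ∈ fs → x ∈F F → x ≡ center F ⊎ Hangs (center F) x
  shape F∈ = All.lookup (star-shaped centers centers-nonempty) F∈

  center∈centers : ∀ {F} → F ∈ fs → center F ∈ centers
  center∈centers {F} F∈ =
    subst (center F ∈_) (centers-stars centers centers-nonempty) (∈-map⁺ center F∈)

  same-center : ∀ {F F' x} → F ∈ fs → F' ∈ fs → x ∈F F → x ∈F F' → center F ≡ center F'
  same-center {F} {F'} {x} F∈ F'∈ x∈F x∈F' = byShapes (shape F∈ x∈F) (shape F'∈ x∈F')
    where
    ¬center : ∀ {G} → G ∈ fs → x ≡ center G → ¬ IsLeaf x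
    ¬center G∈ x≡ = center-not-leaf (center∈centers G∈) ∘ subst IsLeaf x≡

    byShapes : x ≡ center F ⊎ Hangs (center F) x → x ≡ center F' ⊎ Hangs (center F') x →
               center F ≡ center F'
    byShapes (inj₁ x≡y) (inj₁ x≡y') = trans (sym x≡y) x≡y'
    byShapes (inj₁ x≡y) (inj₂ h')   = ⊥-elim (¬center F∈ x≡y (hangs⇒leaf h'))
    byShapes (inj₂ h)   (inj₁ x≡y') = ⊥-elim (¬center F'∈ x≡y' (hangs⇒leaf h))
    byShapes (inj₂ h)   (inj₂ h')   = hangs-functional h h'

  covered-by-star : ∀ {x} → x ∈ cells B → Any (x ∈F_) fs
  covered-by-star {x} x∈B = byCases (isLeaf? x)
    where
    starAt : ∀ {y} → y ∈ centers → x ≡ y ⊎ Hangs y x → Any (x ∈F_) fs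
    starAt y∈ x∈ = let ne , F∈ = ∈-stars⁺ {centers} {centers-nonempty} y∈
                   in lose {P = x ∈F_} F∈ (∈star⁺ {ne = ne} x∈)

    byCases : Dec (IsLeaf x) → Any (x ∈F_) fs
    byCases (yes leaf) = let δ , δ∈ , leaf≡x = find leaf in
      starAt (root∈centers δ∈) (inj₂ (subst (Hangs (root δ)) leaf≡x (root-hangs δ∈)))
    byCases (no ¬leaf) = starAt (∈-filter⁺ (¬? ∘ isLeaf?) x∈B ¬leaf) (inj₁ refl)

  tiling : IsFragmentTiling B fs
  tiling = All.tabulate starInBoard , partition
    where
    starInBoard : ∀ {F} → F ∈ fs → ∀ c → c ∈F F → c ∈ cells B
    starInBoard {F} F∈ c c∈F = byShape (shape F∈ c∈F)
      where
      byShape : c ≡ center F ⊎ Hangs (center F) c → c ∈ cells B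
      byShape (inj₁ c≡y) = subst (_∈ cells B) (sym c≡y) (center∈B (center∈centers F∈))
      byShape (inj₂ h)   = let δ , δ∈ , _ , leaf≡c = find h
                           in subst (_∈ cells B) leaf≡c (inBoard δ∈ (leaf∈D δ))

    unique-centers : Unique (map center fs)
    unique-centers = subst Unique (sym (centers-stars centers centers-nonempty))
                           (Unique.filter⁺ (¬? ∘ isLeaf?) (unique B))

    partition : ∀ x → x ∈ cells B →
                Σ (Fin (length fs)) λ i → x ∈F lookup fs i × (∀ j → x ∈F lookup fs j → j ≡ i)
    partition x x∈B = i , lookup-index covered , λ j x∈Fⱼ →
      Unique[map]⇒lookup-injective center unique-centers j i
        (same-center (∈-lookup j) (∈-lookup i) x∈Fⱼ (lookup-index covered))
      where
      covered = covered-by-star x∈B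
      i = Any.index covered

  fs+ds≤size : length fs + length ds ≤ size B
  fs+ds≤size = begin
    length fs + length ds                 ≡⟨ cong₂ _+_ length-fs (sym (length-map leaf ds)) ⟩
    length centers + length (map leaf ds) ≡⟨ sym (length-++ centers) ⟩
    length (centers ++ map leaf ds)       ≤⟨ Unique⇒length≤ unique-cells cells⊆ ⟩
    size B                                ∎
    where
    open ≤-Reasoning

    length-fs : length fs ≡ length centers
    length-fs = trans (sym (length-map center fs))
                      (cong length (centers-stars centers centers-nonempty))

    leaf∈ : ∀ {x} → x ∈ map leaf ds → IsLeaf x
    leaf∈ x∈ = let δ , δ∈ , x≡ = ∈-map⁻ leaf x∈ in lose δ∈ (sym x≡)

    unique-cells : Unique (centers ++ map leaf ds)
    unique-cells = Unique.++⁺ (Unique.filter⁺ (¬? ∘ isLeaf?) (unique B))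
      (count≤1⇒unique-map _∈D?_ leaf leaf∈D ds (≤-reflexive ∘ leaf-private))
      (λ (x∈c , x∈l) → center-not-leaf x∈c (leaf∈ x∈l))

    cells⊆ : ∀ {x} → x ∈ centers ++ map leaf ds → x ∈ cells B
    cells⊆ x∈ = Sum.[ center∈B , leafInBoard ] (∈-++⁻ centers x∈)
      where
      leafInBoard : ∀ {x} → x ∈ map leaf ds → x ∈ cells B
      leafInBoard x∈ = let δ , δ∈ , x≡ = ∈-map⁻ leaf x∈
                       in subst (_∈ cells B) (sym x≡) (inBoard δ∈ (leaf∈D δ))

saturatedCovering⇒tiling : ∀ B ds → SaturatedCovering B ds →
  ∃[ fs ] IsFragmentTiling B fs × length fs + length ds ≤ size B
saturatedCovering⇒tiling B ds saturatedCovering = fs , tiling , fs+ds≤size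
  where open FromSaturatedCovering B ds saturatedCovering

-- Finite search for a longest saturated covering

listsUpTo : ∀ {A : Set} → ℕ → List A → List (List A)
listsUpTo zero    U = [ [] ]
listsUpTo (suc n) U = [] ∷ cartesianProductWith _∷_ U (listsUpTo n U)

∈-listsUpTo : ∀ {A : Set} {U : List A} n {xs} →
              length xs ≤ n → All (_∈ U) xs → xs ∈ listsUpTo n U
∈-listsUpTo zero    {[]}     _         _          = here refl
∈-listsUpTo (suc n) {[]}     _         _          = here refl
∈-listsUpTo (suc n) {x ∷ xs} (s≤s len) (x∈ ∷ xs∈) =
  there (∈-cartesianProductWith⁺ _∷_ x∈ (∈-listsUpTo n len xs∈))

adj? : ∀ a b → Dec (Adj a b)
adj? a b = ∥ a ⊖ b ∥ ℕ.≟ 1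

dominoBetween : Cell → Cell → List Domino
dominoBetween a b with adj? a b
... | yes adj = [ (a , b) , adj ]
... | no  _   = []

∈-dominoBetween : ∀ {a b} (adj : Adj a b) → ((a , b) , adj) ∈ dominoBetween a b
∈-dominoBetween {a} {b} adj with adj? a b
... | yes adj′ = here (cong ((a , b) ,_) (≡-irrelevant adj adj′))
... | no  ¬adj = ⊥-elim (¬adj adj)

dominoesWithin : List Cell → List Domino
dominoesWithin cs = concatMap (λ a → concatMap (dominoBetween a) cs) cs

∈-dominoesWithin : ∀ {cs} δ → (∀ c → c ∈D δ → c ∈ cs) → δ ∈ dominoesWithin cs
∈-dominoesWithin {cs} ((a , b) , adj) inside =
  ∈-concatMap⁺ (λ a → concatMap (dominoBetween a) cs) (lose (inside a (inj₁ refl))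
    (∈-concatMap⁺ (dominoBetween a) (lose (inside b (inj₂ refl)) (∈-dominoBetween adj))))

module _ (B : Board) where

  Covers : List Domino → Set
  Covers ds = ∀ c → c ∈ cells B → Any (c ∈D_) ds

  within? : ∀ δ → Dec (∀ c → c ∈D δ → c ∈ cells B)
  within? ((a , b) , _) =
    map′ (λ (a∈ , b∈) → λ { _ (inj₁ refl) → a∈ ; _ (inj₂ refl) → b∈ })
         (λ inside → inside a (inj₁ refl) , inside b (inj₂ refl))
         (Any.any? (a ≟ᶜ_) (cells B) ×-dec Any.any? (b ≟ᶜ_) (cells B))

  covers? : ∀ ds → Dec (Covers ds)
  covers? ds = map′ (λ all c → All.lookup all) (λ covers → All.tabulate (covers _))
                    (All.all? (λ c → Any.any? (c ∈D?_) ds) (cells B))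

  ¬covers⇒uncovered : ∀ {ds} → ¬ Covers ds → ∃[ c ] c ∈ cells B × ¬ Any (c ∈D_) ds
  ¬covers⇒uncovered {ds} ¬covers =
    find (¬All⇒Any¬ (λ c → Any.any? (c ∈D?_) ds) (cells B) (¬covers ∘ λ all c → All.lookup all))

  isSaturated? : ∀ ds → Dec (IsSaturated B ds)
  isSaturated? ds =
    map′ (λ ¬covers i → ¬covers⇒uncovered (¬covers i))
         (λ saturated i covers → let c , c∈B , ¬covered = saturated i in ¬covered (covers c c∈B))
         (Fin.all? (λ i → ¬? (covers? (removeAt ds i))))

  saturatedCovering? : Decidable (SaturatedCovering B)
  saturatedCovering? ds = (All.all? within? ds ×-dec covers? ds) ×-dec isSaturated? ds

  saturate : ∀ n ds → length ds ≡ n → IsDominoCovering B ds → ∃[ es ] SaturatedCovering B es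
  saturate zero    []      _  covering = [] , covering , λ ()
  saturate zero    (_ ∷ _) ()
  saturate (suc n) ds len (inside , covers) with Fin.any? (λ i → covers? (removeAt ds i))
  ... | yes (i , covers′) =
    saturate n (removeAt ds i) (suc-injective (trans (sym (length-removeAt′ ds i)) len))
             (All-removeAt ds i inside , covers′)
  ... | no ¬removable = ds , (inside , covers) , λ i → ¬covers⇒uncovered (¬removable ∘ (i ,_))

  neighbourDominoes : List Domino
  neighbourDominoes = mapWith∈ (cells B) λ {c} c∈ → let c′ , _ , adj = nbr B c c∈ in (c , c′) , adj

  neighbourDominoes-covering : IsDominoCovering B neighbourDominoes
  neighbourDominoes-covering = All.tabulate inside , λ c c∈ → Any.mapWith∈⁺ _ (c , c∈ , inj₁ refl)
    where
    inside : ∀ {δ} → δ ∈ neighbourDominoes → ∀ c → c ∈D δ → c ∈ cells B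
    inside δ∈ with c , c∈ , refl ← Any.mapWith∈⁻ (cells B) _ δ∈ = λ
      { _ (inj₁ refl) → c∈
      ; _ (inj₂ refl) → proj₁ (proj₂ (nbr B c c∈)) }

  someSaturatedCovering : ∃[ ds ] SaturatedCovering B ds
  someSaturatedCovering = saturate _ neighbourDominoes refl neighbourDominoes-covering

  candidates : List (List Domino)
  candidates = listsUpTo (size B) (dominoesWithin (cells B))

  ∈-candidates : ∀ {ds} → SaturatedCovering B ds → ds ∈ candidates
  ∈-candidates {ds} saturatedCovering =
    ∈-listsUpTo (size B) (m+n≤o⇒n≤o _ fs+ds≤size)
                (All.map (∈-dominoesWithin _) (proj₁ (proj₁ saturatedCovering)))
    where fs+ds≤size = proj₂ (proj₂ (saturatedCovering⇒tiling B ds saturatedCovering))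

  longestSaturatedCovering :
    ∃[ ds ] SaturatedCovering B ds × (∀ es → SaturatedCovering B es → length es ≤ length ds)
  longestSaturatedCovering =
    longest ,
    argmax-all length {xs = saturated} (proj₂ someSaturatedCovering)
      (All.tabulate (proj₂ ∘ ∈-filter⁻ saturatedCovering? {xs = candidates})) ,
    λ es sc → All.lookup (f[xs]≤f[argmax] {f = length} (proj₁ someSaturatedCovering) saturated)
                         (∈-filter⁺ saturatedCovering? (∈-candidates sc) sc)
    where
    saturated = filter saturatedCovering? candidates
    longest = argmax length (proj₁ someSaturatedCovering) saturated

module _ (B : Board) {ds : List Domino} (saturatedCovering : SaturatedCovering B ds)
         (longest : ∀ es → SaturatedCovering B es → length es ≤ length ds) where

  size≤tiling+longest : ∀ gs → IsFragmentTiling B gs → size B ≤ length gs + length ds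
  size≤tiling+longest gs tiling =
    let es , covering′ , saturated′ , size≤gs+es = tiling⇒saturatedCovering B gs tiling
    in ≤-trans size≤gs+es (+-monoʳ-≤ (length gs) (longest es (covering′ , saturated′)))

  longest-isD : IsD B (length ds)
  longest-isD = (ds , proj₁ saturatedCovering , proj₂ saturatedCovering , refl) ,
                λ es covering saturated → longest es (covering , saturated)

  longest⇒d+f≡size : ∃[ m ] (IsD B (length ds) × IsF B m × length ds + m ≡ size B)
  longest⇒d+f≡size =
    let fs , tiling , fs+ds≤size = saturatedCovering⇒tiling B ds saturatedCovering

        fewest : ∀ gs → IsFragmentTiling B gs → length fs ≤ length gs
        fewest gs tiling′ =
          +-cancelʳ-≤ (length ds) _ _ (≤-trans fs+ds≤size (size≤tiling+longest gs tiling′))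

        ds+fs≡size : length ds + length fs ≡ size B
        ds+fs≡size =
          ≤-antisym (≤-trans (≤-reflexive (+-comm (length ds) (length fs))) fs+ds≤size)
                    (≤-trans (size≤tiling+longest fs tiling) (≤-reflexive (+-comm (length fs) (length ds))))
    in length fs , longest-isD , ((fs , tiling , refl) , fewest) , ds+fs≡size

mainTheorem2 : (B : Board) → ∃[ n ] ∃[ m ] (IsD B n × IsF B m × n + m ≡ size B)
mainTheorem2 B =
  let ds , saturatedCovering , longest = longestSaturatedCovering B
  in length ds , longest⇒d+f≡size B saturatedCovering longest
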